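{- For all $n>2$, $\det'(P_n)=1$; for every cycle $C_n$ ($n\ge 3$), $\det'(C_n)=2$; and for all $n>1$, $\det'(K_{1,n})=n-1$.
   Context: $P_n$ is the path on $n$ vertices, $C_n$ the cycle on $n$ vertices, $K_{1,n}$ the star with $n$ leaves. For a graph with at most one isolated vertex and no $K_2$ component, an edge set $T$ is an edge determining set if the only automorphism $\phi$ with $\{\phi(u),\phi(v)\}=\{u,v\}$ for all $\{u,v\}\in T$ is the identity; the determining index $\det'(G)$ is the minimum size of such a set. -}

module Defs where

open import Data.Nat using (ℕ; zero; suc; _∸_; _≤_)
open import Data.Fin using (Fin; toℕ)
open import Data.Fin.Permutation using (Permutation′; _⟨$⟩ʳ_)
open import Data.Product using (_×_; _,_; Σ)
open import Data.Sum using (_⊎_)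
open import Data.List using (List; length)
open import Data.List.Membership.Propositional using (_∈_)
open import Data.List.Relation.Unary.All using (All)
open import Relation.Binary.PropositionalEquality using (_≡_)
open import Function.Bundles using (_⇔_)

record Graph : Set₁ where
  field
    order : ℕ
    Adj   : Fin order → Fin order → Set
open Graph public

IsAutomorphism : (G : Graph) → Permutation′ (order G) → Set
IsAutomorphism G φ = ∀ u v → Adj G u v ⇔ Adj G (φ ⟨$⟩ʳ u) (φ ⟨$⟩ʳ v)

-- An edge {u,v} is represented by an ordered pair (u , v) with u adjacent to v.
Edge : Graph → Set
Edge G = Fin (order G) × Fin (order G)

IsEdgeList : (G : Graph) → List (Edge G) → Set
IsEdgeList G T = All (λ e → Adj G (Data.Product.proj₁ e) (Data.Product.proj₂ e)) T

FixesEdge : (G : Graph) → Permutation′ (order G) → Edge G → Set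
FixesEdge G φ (u , v) = ((φ ⟨$⟩ʳ u) ≡ u × (φ ⟨$⟩ʳ v) ≡ v) ⊎ ((φ ⟨$⟩ʳ u) ≡ v × (φ ⟨$⟩ʳ v) ≡ u)

IsEdgeDetermining : (G : Graph) → List (Edge G) → Set
IsEdgeDetermining G T =
  IsEdgeList G T ×
  (∀ φ → IsAutomorphism G φ → (∀ e → e ∈ T → FixesEdge G φ e) → ∀ x → (φ ⟨$⟩ʳ x) ≡ x)

-- det'(G) = k : there is an edge determining set of size k and none of smaller size.
-- (Minimising the length of lists of edges is the same as minimising the cardinality
--  of edge sets, since duplicates can only increase the length.)
DetIndex : Graph → ℕ → Set
DetIndex G k =
  Σ (List (Edge G)) (λ T → length T ≡ k × IsEdgeDetermining G T) ×
  (∀ T → IsEdgeDetermining G T → k ≤ length T)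

Path : ℕ → Graph
Path n = record { order = n ; Adj = λ i j → (toℕ j ≡ suc (toℕ i)) ⊎ (toℕ i ≡ suc (toℕ j)) }

Cycle : ℕ → Graph
Cycle n = record { order = n ; Adj = λ i j →
  ((toℕ j ≡ suc (toℕ i)) ⊎ (toℕ i ≡ suc (toℕ j))) ⊎
  ((toℕ i ≡ 0 × toℕ j ≡ n ∸ 1) ⊎ (toℕ j ≡ 0 × toℕ i ≡ n ∸ 1)) }

Star : ℕ → Graph
Star n = record { order = suc n ; Adj = λ i j →
  (toℕ i ≡ 0 × 1 ≤ toℕ j) ⊎ (toℕ j ≡ 0 × 1 ≤ toℕ i) }

-- An automorphism of P_n fixing the edge {0,1} setwise cannot swap 0 and 1,
-- since the image of 2 would have to be the unique neighbour 1 of 0; once 0 and 1 are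
-- fixed, every vertex is fixed by induction along the path, as its only neighbours are
-- its predecessor and successor. On C_n the edges {1,0} and {1,2} force 1, then 0 and 2,
-- to be fixed, and the same induction applies. Every automorphism of K_{1,n} fixes the
-- centre, so fixing n-1 spokes fixes n-1 leaves and hence also the last one. The reversal of P_n and C_n is a nontrivial automorphism. Every edge of
-- C_n is swapped by a reflection: the reversal swaps {n-1,0}, and conjugating by the
-- rotation (a product of two reflections) moves this to any other edge. If fewer than
-- n-1 edges of K_{1,n} are given, two leaves are untouched and transposing them is a
-- nontrivial automorphism fixing every given edge.

module Submission where

open import Defs
open import Data.Nat using (ℕ; zero; suc; _+_; _<_; _≤_; _∸_; z≤n; s≤s)
open import Data.Nat.Properties
  using (≤-reflexive; ≤-trans; n≤1+n; m≤n⇒m<n∨m≡n; m≤n⇒m≤1+n; <⇒≤; <⇒≱; ≮⇒≥; ≤-pred;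
         suc-injective; 1+n≢n; n≮0)
open import Data.Fin as Fin using (Fin; zero; suc; toℕ; inject₁; fromℕ; opposite)
open import Data.Fin.Properties
  using (toℕ-injective; toℕ-inject₁; toℕ-fromℕ; opposite-involutive; injective⇒≤; all?; ¬∀⟶∃¬)
  renaming (_≟_ to _≟ᶠ_)
open import Data.Fin.Induction using (<-wellFounded; <-weakInduction)
open import Data.Fin.Permutation
  using (Permutation′; _⟨$⟩ʳ_; _∘ₚ_; flip; reverse; lift₀; transpose; inverseˡ; inverseʳ)
import Data.Fin.Permutation.Components as PC
import Data.List.Membership.DecPropositional as DecMem
open import Data.Product using (Σ; ∃; _×_; _,_)
open import Data.Sum as Sum using (_⊎_; inj₁; inj₂)
open import Data.Empty using (⊥-elim)
open import Data.List using (List; []; _∷_; length; map; allFin; lookup)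
open import Data.List.Properties using (length-map; length-tabulate)
open import Data.List.Relation.Unary.All as All using ([]; _∷_)
open import Data.List.Relation.Unary.All.Properties using (map⁺)
open import Data.List.Relation.Unary.Any as Any using (here; there)
open import Data.List.Relation.Unary.Any.Properties using (lookup-index)
open import Data.List.Membership.Propositional using (_∈_; _∉_)
open import Data.List.Membership.Propositional.Properties using (∈-map⁺; ∈-allFin)
open import Function.Bundles using (_⇔_; mk⇔; Equivalence; Injection)
open import Function.Construct.Composition using (_⇔-∘_)
open import Function.Properties.Inverse using (↔⇒↣)
open import Induction.WellFounded using (Acc; acc)
open import Relation.Nullary using (¬_; yes; no; contradiction)
open import Relation.Binary.PropositionalEquality

private
  variable
    n m : ℕ

⟨$⟩ʳ-injective : (φ : Permutation′ n) {x y : Fin n} → φ ⟨$⟩ʳ x ≡ φ ⟨$⟩ʳ y → x ≡ y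
⟨$⟩ʳ-injective φ = Injection.injective (↔⇒↣ φ)

fixed-if-others-fixed : (φ : Permutation′ n) {x : Fin n} →
  (∀ y → y ≢ x → φ ⟨$⟩ʳ y ≡ y) → φ ⟨$⟩ʳ x ≡ x
fixed-if-others-fixed φ {x} others with φ ⟨$⟩ʳ x ≟ᶠ x
... | yes fixed = fixed
... | no moved  = ⊥-elim (moved (⟨$⟩ʳ-injective φ (others _ moved)))

fixed-if-not-raised : (φ : Permutation′ n) {x : Fin n} →
  (∀ y → toℕ y < toℕ x → φ ⟨$⟩ʳ y ≡ y) → toℕ (φ ⟨$⟩ʳ x) ≤ toℕ x → φ ⟨$⟩ʳ x ≡ x
fixed-if-not-raised φ {x} below not-raised with m≤n⇒m<n∨m≡n not-raised
... | inj₁ lowered = ⟨$⟩ʳ-injective φ (below _ lowered)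
... | inj₂ same    = toℕ-injective same

identity-if-never-raised : (φ : Permutation′ n) →
  (∀ x → (∀ y → toℕ y < toℕ x → φ ⟨$⟩ʳ y ≡ y) → toℕ (φ ⟨$⟩ʳ x) ≤ toℕ x) →
  ∀ x → φ ⟨$⟩ʳ x ≡ x
identity-if-never-raised φ never-raised x = go x (<-wellFounded x)
  where
  go : ∀ x → Acc Fin._<_ x → φ ⟨$⟩ʳ x ≡ x
  go x (acc rs) = fixed-if-not-raised φ below (never-raised x below)
    where
    below : ∀ y → toℕ y < toℕ x → φ ⟨$⟩ʳ y ≡ y
    below y y<x = go y (rs y<x)

identity-if-fixes-0-1 : (φ : Permutation′ (suc (suc m))) →
  φ ⟨$⟩ʳ zero ≡ zero → φ ⟨$⟩ʳ suc zero ≡ suc zero →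
  (∀ x → φ ⟨$⟩ʳ inject₁ (suc x) ≡ inject₁ (suc x) →
         toℕ (φ ⟨$⟩ʳ suc (suc x)) ≤ suc (toℕ (inject₁ (suc x)))) →
  ∀ x → φ ⟨$⟩ʳ x ≡ x
identity-if-fixes-0-1 φ fixes-0 fixes-1 step = identity-if-never-raised φ not-raised
  where
  not-raised : ∀ x → (∀ y → toℕ y < toℕ x → φ ⟨$⟩ʳ y ≡ y) → toℕ (φ ⟨$⟩ʳ x) ≤ toℕ x
  not-raised zero          _     = ≤-reflexive (cong toℕ fixes-0)
  not-raised (suc zero)    _     = ≤-reflexive (cong toℕ fixes-1)
  not-raised (suc (suc x)) below =
    subst (λ t → toℕ (φ ⟨$⟩ʳ suc (suc x)) ≤ suc (suc t)) (toℕ-inject₁ x)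
      (step x (below (inject₁ (suc x)) (s≤s (s≤s (≤-reflexive (toℕ-inject₁ x))))))

module _ (G : Graph) where

  private
    V : Set
    V = Fin (order G)

  involution-isAutomorphism : (φ : Permutation′ (order G)) → (∀ x → φ ⟨$⟩ʳ (φ ⟨$⟩ʳ x) ≡ x) →
    (∀ u v → Adj G u v → Adj G (φ ⟨$⟩ʳ u) (φ ⟨$⟩ʳ v)) → IsAutomorphism G φ
  involution-isAutomorphism φ involutive preserves u v = mk⇔ (preserves u v) reflect
    where
    reflect : Adj G (φ ⟨$⟩ʳ u) (φ ⟨$⟩ʳ v) → Adj G u v
    reflect adj = subst₂ (Adj G) (involutive u) (involutive v) (preserves _ _ adj)

  orientation-reversing-isAutomorphism : (R : V → V → Set) →
    (∀ {u v} → Adj G u v ⇔ (R u v ⊎ R v u)) →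
    (φ : Permutation′ (order G)) → (∀ x → φ ⟨$⟩ʳ (φ ⟨$⟩ʳ x) ≡ x) →
    (∀ {u v} → R u v → R (φ ⟨$⟩ʳ v) (φ ⟨$⟩ʳ u)) → IsAutomorphism G φ
  orientation-reversing-isAutomorphism R adj⇔ φ involutive reverses =
    involution-isAutomorphism φ involutive λ u v adj →
      Equivalence.from adj⇔ (Sum.swap (Sum.map reverses reverses (Equivalence.to adj⇔ adj)))

  ∘ₚ-isAutomorphism : (φ ψ : Permutation′ (order G)) →
    IsAutomorphism G φ → IsAutomorphism G ψ → IsAutomorphism G (φ ∘ₚ ψ)
  ∘ₚ-isAutomorphism φ ψ φ-aut ψ-aut u v = ψ-aut _ _ ⇔-∘ φ-aut u v

  flip-isAutomorphism : (φ : Permutation′ (order G)) → IsAutomorphism G φ → IsAutomorphism G (flip φ)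
  flip-isAutomorphism φ φ-aut u v = mk⇔
    (λ adj → Equivalence.from (φ-aut _ _) (subst₂ (Adj G) (sym (inverseʳ φ)) (sym (inverseʳ φ)) adj))
    (λ adj → subst₂ (Adj G) (inverseʳ φ) (inverseʳ φ) (Equivalence.to (φ-aut _ _) adj))

  Flips : V → V → Set
  Flips u v = Σ (Permutation′ (order G)) λ σ → IsAutomorphism G σ × σ ⟨$⟩ʳ u ≡ v × σ ⟨$⟩ʳ v ≡ u

  Flips-sym : {u v : V} → Flips u v → Flips v u
  Flips-sym (σ , σ-aut , u↦v , v↦u) = σ , σ-aut , v↦u , u↦v

  Flips-image : {u v : V} (τ : Permutation′ (order G)) → IsAutomorphism G τ →
    Flips u v → Flips (τ ⟨$⟩ʳ u) (τ ⟨$⟩ʳ v)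
  Flips-image {u} {v} τ τ-aut (σ , σ-aut , u↦v , v↦u) =
    flip τ ∘ₚ σ ∘ₚ τ ,
    ∘ₚ-isAutomorphism (flip τ) (σ ∘ₚ τ) (flip-isAutomorphism τ τ-aut) (∘ₚ-isAutomorphism σ τ σ-aut τ-aut) ,
    cong (τ ⟨$⟩ʳ_) (trans (cong (σ ⟨$⟩ʳ_) (inverseˡ τ)) u↦v) ,
    cong (τ ⟨$⟩ʳ_) (trans (cong (σ ⟨$⟩ʳ_) (inverseˡ τ)) v↦u)

  moved⇒¬IsEdgeDetermining : (φ : Permutation′ (order G)) {T : List (Edge G)} (x : V) →
    IsAutomorphism G φ → (∀ e → e ∈ T → FixesEdge G φ e) → φ ⟨$⟩ʳ x ≢ x →
    ¬ IsEdgeDetermining G T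
  moved⇒¬IsEdgeDetermining φ x φ-aut fixes moved (_ , determining) =
    moved (determining φ φ-aut fixes x)

  fixed-neighbour-image : (φ : Permutation′ (order G)) {p x : V} →
    IsAutomorphism G φ → Adj G p x → φ ⟨$⟩ʳ p ≡ p → Adj G p (φ ⟨$⟩ʳ x)
  fixed-neighbour-image φ {p} {x} φ-aut adj p↦p =
    subst (λ q → Adj G q (φ ⟨$⟩ʳ x)) p↦p (Equivalence.to (φ-aut p x) adj)

  common-endpoint-fixed : (φ : Permutation′ (order G)) {c u v : V} →
    FixesEdge G φ (c , u) → FixesEdge G φ (c , v) → u ≢ v → φ ⟨$⟩ʳ c ≡ c
  common-endpoint-fixed _ (inj₁ (c↦c , _)) _                 _   = c↦c
  common-endpoint-fixed _ (inj₂ _)          (inj₁ (c↦c , _)) _   = c↦c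
  common-endpoint-fixed _ (inj₂ (c↦u , _))  (inj₂ (c↦v , _)) u≢v = ⊥-elim (u≢v (trans (sym c↦u) c↦v))

  other-endpoint-fixed : (φ : Permutation′ (order G)) {u v : V} →
    FixesEdge G φ (u , v) → φ ⟨$⟩ʳ u ≡ u → u ≢ v → φ ⟨$⟩ʳ v ≡ v
  other-endpoint-fixed _ (inj₁ (_ , v↦v)) _   _   = v↦v
  other-endpoint-fixed _ (inj₂ (u↦v , _)) u↦u u≢v = ⊥-elim (u≢v (trans (sym u↦u) u↦v))

data Consecutive : Fin n → Fin n → Set where
  consecutive : (k : Fin m) → Consecutive (inject₁ k) (suc k)

Consecutive⇒toℕ-suc : {i j : Fin n} → Consecutive i j → toℕ j ≡ suc (toℕ i)
Consecutive⇒toℕ-suc (consecutive k) = cong suc (sym (toℕ-inject₁ k))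

toℕ-suc⇒Consecutive : {i j : Fin n} → toℕ j ≡ suc (toℕ i) → Consecutive i j
toℕ-suc⇒Consecutive {i = i} {suc k} eq
  rewrite toℕ-injective {i = i} {inject₁ k} (trans (suc-injective (sym eq)) (sym (toℕ-inject₁ k)))
  = consecutive k

Consecutive-irreflexive : {i : Fin n} → ¬ Consecutive i i
Consecutive-irreflexive c = 1+n≢n (sym (Consecutive⇒toℕ-suc c))

Consecutive-suc : {i j : Fin n} → Consecutive i j → Consecutive (suc i) (suc j)
Consecutive-suc (consecutive k) = consecutive (suc k)

opposite-inject₁ : (k : Fin m) → opposite (inject₁ k) ≡ suc (opposite k)
opposite-inject₁ {suc zero}    zero    = refl
opposite-inject₁ {suc (suc m)} zero    = refl
opposite-inject₁               (suc k) = cong inject₁ (opposite-inject₁ k)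

opposite-fromℕ : ∀ m → opposite (fromℕ m) ≡ zero
opposite-fromℕ zero    = refl
opposite-fromℕ (suc m) = cong inject₁ (opposite-fromℕ m)

opposite-reverses-Consecutive : {i j : Fin n} → Consecutive i j → Consecutive (opposite j) (opposite i)
opposite-reverses-Consecutive (consecutive k)
  rewrite opposite-inject₁ k = consecutive (opposite k)

Path-adj⇔ : {u v : Fin n} → Adj (Path n) u v ⇔ (Consecutive u v ⊎ Consecutive v u)
Path-adj⇔ = mk⇔ (Sum.map toℕ-suc⇒Consecutive toℕ-suc⇒Consecutive)
                (Sum.map Consecutive⇒toℕ-suc Consecutive⇒toℕ-suc)

data CyclicSucc : Fin (suc m) → Fin (suc m) → Set where
  step : {i j : Fin (suc m)} → Consecutive i j → CyclicSucc i j
  wrap : CyclicSucc (fromℕ m) zero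

Cycle-adj⇔ : {u v : Fin (suc m)} → Adj (Cycle (suc m)) u v ⇔ (CyclicSucc u v ⊎ CyclicSucc v u)
Cycle-adj⇔ {m} = mk⇔ to from
  where
  to : {u v : Fin (suc m)} → Adj (Cycle (suc m)) u v → CyclicSucc u v ⊎ CyclicSucc v u
  to (inj₁ path) = Sum.map step step (Equivalence.to Path-adj⇔ path)
  to (inj₂ (inj₁ (u≡0 , v≡m)))
    rewrite toℕ-injective {j = zero} u≡0 | toℕ-injective (trans v≡m (sym (toℕ-fromℕ m))) = inj₂ wrap
  to (inj₂ (inj₂ (v≡0 , u≡m)))
    rewrite toℕ-injective {j = zero} v≡0 | toℕ-injective (trans u≡m (sym (toℕ-fromℕ m))) = inj₁ wrap
  from : {u v : Fin (suc m)} → CyclicSucc u v ⊎ CyclicSucc v u → Adj (Cycle (suc m)) u v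
  from (inj₁ (step c)) = inj₁ (inj₁ (Consecutive⇒toℕ-suc c))
  from (inj₁ wrap)     = inj₂ (inj₂ (refl , toℕ-fromℕ m))
  from (inj₂ (step c)) = inj₁ (inj₂ (Consecutive⇒toℕ-suc c))
  from (inj₂ wrap)     = inj₂ (inj₁ (refl , toℕ-fromℕ m))

Path-neighbour-≤ : {u v : Fin n} → Adj (Path n) u v → toℕ v ≤ suc (toℕ u)
Path-neighbour-≤ (inj₁ v≡1+u) = ≤-reflexive v≡1+u
Path-neighbour-≤ (inj₂ u≡1+v) = m≤n⇒m≤1+n (<⇒≤ (≤-reflexive (sym u≡1+v)))

Cycle-neighbour-≤ : {u v : Fin n} → 1 ≤ toℕ u → Adj (Cycle n) u v → toℕ v ≤ suc (toℕ u)
Cycle-neighbour-≤ _     (inj₁ path)              = Path-neighbour-≤ path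
Cycle-neighbour-≤ 1≤u   (inj₂ (inj₁ (u≡0 , _))) = ⊥-elim (n≮0 (subst (1 ≤_) u≡0 1≤u))
Cycle-neighbour-≤ _     (inj₂ (inj₂ (v≡0 , _))) = subst (_≤ _) (sym v≡0) z≤n

reverse-isAutomorphism-Path : IsAutomorphism (Path n) reverse
reverse-isAutomorphism-Path = orientation-reversing-isAutomorphism (Path _) Consecutive Path-adj⇔
  reverse opposite-involutive opposite-reverses-Consecutive

reverse-isAutomorphism-Cycle : IsAutomorphism (Cycle (suc m)) reverse
reverse-isAutomorphism-Cycle {m} = orientation-reversing-isAutomorphism (Cycle _) CyclicSucc Cycle-adj⇔
  reverse opposite-involutive reverses
  where
  reverses : {u v : Fin (suc m)} → CyclicSucc u v → CyclicSucc (opposite v) (opposite u)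
  reverses (step c) = step (opposite-reverses-Consecutive c)
  reverses wrap rewrite opposite-fromℕ m = wrap

lift₀-reverse-isAutomorphism : IsAutomorphism (Cycle (suc (suc m))) (lift₀ reverse)
lift₀-reverse-isAutomorphism {m} = orientation-reversing-isAutomorphism (Cycle _) CyclicSucc Cycle-adj⇔
  ψ involutive reverses
  where
  ψ : Permutation′ (suc (suc m))
  ψ = lift₀ reverse
  involutive : ∀ x → ψ ⟨$⟩ʳ (ψ ⟨$⟩ʳ x) ≡ x
  involutive zero    = refl
  involutive (suc x) = cong suc (opposite-involutive x)
  reverses : {u v : Fin (suc (suc m))} → CyclicSucc u v → CyclicSucc (ψ ⟨$⟩ʳ v) (ψ ⟨$⟩ʳ u)
  reverses (step (consecutive zero))    = wrap
  reverses (step (consecutive (suc k))) = step (Consecutive-suc (opposite-reverses-Consecutive (consecutive k)))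
  reverses wrap rewrite opposite-fromℕ m = step (consecutive zero)

rotate : Permutation′ (suc (suc m))
rotate = reverse ∘ₚ lift₀ reverse

rotate-isAutomorphism : IsAutomorphism (Cycle (suc (suc m))) rotate
rotate-isAutomorphism = ∘ₚ-isAutomorphism (Cycle _) reverse (lift₀ reverse)
  reverse-isAutomorphism-Cycle lift₀-reverse-isAutomorphism

rotate-inject₁ : (k : Fin (suc m)) → rotate ⟨$⟩ʳ inject₁ k ≡ suc k
rotate-inject₁ k rewrite opposite-inject₁ k = cong suc (opposite-involutive k)

rotate-fromℕ : ∀ m → rotate ⟨$⟩ʳ fromℕ (suc m) ≡ zero
rotate-fromℕ m rewrite opposite-fromℕ (suc m) = refl

-- Every edge of the cycle is the image of {n-1, 0} under a power of the rotation.
Cycle-successor-Flips : (k : Fin (suc m)) → Flips (Cycle (suc (suc m))) (inject₁ k) (suc k)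
Cycle-successor-Flips {m} = <-weakInduction (λ k → Flips C (inject₁ k) (suc k)) base next
  where
  C : Graph
  C = Cycle (suc (suc m))
  wrap-Flips : Flips C (fromℕ (suc m)) zero
  wrap-Flips = reverse , reverse-isAutomorphism-Cycle , opposite-fromℕ (suc m) , refl
  rotated : {u v : Fin (suc (suc m))} → Flips C u v → Flips C (rotate ⟨$⟩ʳ u) (rotate ⟨$⟩ʳ v)
  rotated = Flips-image C rotate rotate-isAutomorphism
  base : Flips C zero (suc zero)
  base = subst₂ (Flips C) (rotate-fromℕ m) (rotate-inject₁ zero) (rotated wrap-Flips)
  next : ∀ k → Flips C (inject₁ (inject₁ k)) (suc (inject₁ k)) → Flips C (inject₁ (suc k)) (suc (suc k))
  next k flips = subst₂ (Flips C) (rotate-inject₁ (inject₁ k)) (rotate-inject₁ (suc k)) (rotated flips)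

CyclicSucc-Flips : {u v : Fin (suc (suc m))} → CyclicSucc u v → Flips (Cycle (suc (suc m))) u v
CyclicSucc-Flips (step (consecutive k)) = Cycle-successor-Flips k
CyclicSucc-Flips {m} wrap = reverse , reverse-isAutomorphism-Cycle , opposite-fromℕ (suc m) , refl

Cycle-edge-Flips : {u v : Fin (suc (suc m))} → Adj (Cycle (suc (suc m))) u v → Flips (Cycle (suc (suc m))) u v
Cycle-edge-Flips adj with Equivalence.to Cycle-adj⇔ adj
... | inj₁ u↦v = CyclicSucc-Flips u↦v
... | inj₂ v↦u = Flips-sym (Cycle _) (CyclicSucc-Flips v↦u)

Cycle-irreflexive : {u v : Fin (suc (suc m))} → Adj (Cycle (suc (suc m))) u v → u ≢ v
Cycle-irreflexive adj refl with Equivalence.to Cycle-adj⇔ adj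
... | inj₁ (step c) = Consecutive-irreflexive c
... | inj₂ (step c) = Consecutive-irreflexive c

Path-neighbour-of-zero : {v : Fin (suc (suc m))} → Adj (Path (suc (suc m))) zero v → v ≡ suc zero
Path-neighbour-of-zero (inj₁ v≡1) = toℕ-injective v≡1

Path-first-edge-fixed : ∀ {k} (φ : Permutation′ (3 + k)) → IsAutomorphism (Path (3 + k)) φ →
  FixesEdge (Path (3 + k)) φ (zero , suc zero) → φ ⟨$⟩ʳ zero ≡ zero × φ ⟨$⟩ʳ suc zero ≡ suc zero
Path-first-edge-fixed φ φ-aut (inj₁ fixed) = fixed
Path-first-edge-fixed φ φ-aut (inj₂ (0↦1 , 1↦0)) = contradiction (⟨$⟩ʳ-injective φ 2↦φ0) λ ()
  where
  -- 2 is adjacent to 1 ↦ 0, whose only neighbour is 1 = φ 0.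
  2↦φ0 : φ ⟨$⟩ʳ suc (suc zero) ≡ φ ⟨$⟩ʳ zero
  2↦φ0 = trans (Path-neighbour-of-zero (subst (λ q → Adj (Path _) q (φ ⟨$⟩ʳ suc (suc zero))) 1↦0
                 (Equivalence.to (φ-aut (suc zero) (suc (suc zero))) (inj₁ refl))))
               (sym 0↦1)

Path-index : ∀ n → 2 < n → DetIndex (Path n) 1
Path-index (suc (suc (suc k))) _ = (T , refl , (inj₁ refl ∷ []) , determined) , lower-bound
  where
  P : Graph
  P = Path (3 + k)
  T : List (Edge P)
  T = (zero , suc zero) ∷ []
  determined : ∀ φ → IsAutomorphism P φ → (∀ e → e ∈ T → FixesEdge P φ e) → ∀ x → φ ⟨$⟩ʳ x ≡ x
  determined φ φ-aut fixes with Path-first-edge-fixed φ φ-aut (fixes _ (here refl))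
  ... | fixes-0 , fixes-1 = identity-if-fixes-0-1 φ fixes-0 fixes-1 λ x p↦p →
    Path-neighbour-≤ (fixed-neighbour-image P φ φ-aut (inj₁ (Consecutive⇒toℕ-suc (consecutive (suc x)))) p↦p)
  lower-bound : ∀ T → IsEdgeDetermining P T → 1 ≤ length T
  lower-bound []      determining =
    ⊥-elim (moved⇒¬IsEdgeDetermining P reverse zero reverse-isAutomorphism-Path (λ _ ()) (λ ()) determining)
  lower-bound (_ ∷ _) _ = s≤s z≤n
Path-index (suc zero)       (s≤s ())
Path-index (suc (suc zero)) (s≤s (s≤s ()))

Cycle-index : ∀ n → 3 ≤ n → DetIndex (Cycle n) 2
Cycle-index (suc (suc (suc k))) _ =
  (T , refl , (inj₁ (inj₂ refl) ∷ inj₁ (inj₁ refl) ∷ []) , determined) , lower-bound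
  where
  C : Graph
  C = Cycle (3 + k)
  T : List (Edge C)
  T = (suc zero , zero) ∷ (suc zero , suc (suc zero)) ∷ []
  determined : ∀ φ → IsAutomorphism C φ → (∀ e → e ∈ T → FixesEdge C φ e) → ∀ x → φ ⟨$⟩ʳ x ≡ x
  determined φ φ-aut fixes = identity-if-fixes-0-1 φ fixes-0 fixes-1 λ x p↦p →
    Cycle-neighbour-≤ (s≤s z≤n)
      (fixed-neighbour-image C φ φ-aut (inj₁ (inj₁ (Consecutive⇒toℕ-suc (consecutive (suc x))))) p↦p)
    where
    fixes-1 : φ ⟨$⟩ʳ suc zero ≡ suc zero
    fixes-1 = common-endpoint-fixed C φ (fixes _ (here refl)) (fixes _ (there (here refl))) (λ ())
    fixes-0 : φ ⟨$⟩ʳ zero ≡ zero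
    fixes-0 = other-endpoint-fixed C φ (fixes _ (here refl)) fixes-1 (λ ())
  lower-bound : ∀ T → IsEdgeDetermining C T → 2 ≤ length T
  lower-bound [] determining =
    ⊥-elim (moved⇒¬IsEdgeDetermining C reverse zero reverse-isAutomorphism-Cycle (λ _ ()) (λ ()) determining)
  lower-bound ((u , v) ∷ []) determining@(adj ∷ [] , _)
    with σ , σ-aut , u↦v , v↦u ← Cycle-edge-Flips adj =
    ⊥-elim (moved⇒¬IsEdgeDetermining C σ u σ-aut flips-edge
             (λ u↦u → Cycle-irreflexive adj (trans (sym u↦u) u↦v)) determining)
    where
    flips-edge : ∀ e → e ∈ (u , v) ∷ [] → FixesEdge C σ e
    flips-edge _ (here refl) = inj₂ (u↦v , v↦u)
  lower-bound (_ ∷ _ ∷ _) _ = s≤s (s≤s z≤n)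
Cycle-index (suc zero)       (s≤s ())
Cycle-index (suc (suc zero)) (s≤s (s≤s ()))

Star-leaf-neighbour : {i : Fin n} {w : Fin (suc n)} → Adj (Star n) (suc i) w → w ≡ zero
Star-leaf-neighbour (inj₂ (w≡0 , _)) = toℕ-injective w≡0

Star-automorphism-fixes-centre : ∀ {k} (φ : Permutation′ (3 + k)) →
  IsAutomorphism (Star (2 + k)) φ → φ ⟨$⟩ʳ zero ≡ zero
Star-automorphism-fixes-centre φ φ-aut with φ ⟨$⟩ʳ zero in centre-image
... | zero  = refl
... | suc i = contradiction (⟨$⟩ʳ-injective φ (trans (leaf-image zero) (sym (leaf-image (suc zero))))) λ ()
  where
  -- If the centre went to a leaf, every leaf would go to that leaf's only neighbour.
  leaf-image : ∀ j → φ ⟨$⟩ʳ suc j ≡ zero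
  leaf-image j = Star-leaf-neighbour (subst (λ c → Adj (Star _) c (φ ⟨$⟩ʳ suc j)) centre-image
                   (Equivalence.to (φ-aut zero (suc j)) (inj₁ (refl , s≤s z≤n))))

centre-fixing-isAutomorphism : (φ : Permutation′ (suc n)) → φ ⟨$⟩ʳ zero ≡ zero → IsAutomorphism (Star n) φ
centre-fixing-isAutomorphism {n} φ 0↦0 u v = mk⇔ (forward u v) (backward u v)
  where
  leaf↦leaf : ∀ i → 1 ≤ toℕ (φ ⟨$⟩ʳ suc i)
  leaf↦leaf i with φ ⟨$⟩ʳ suc i in leaf-image
  ... | zero  = contradiction (⟨$⟩ʳ-injective φ (trans leaf-image (sym 0↦0))) λ ()
  ... | suc _ = s≤s z≤n
  forward : ∀ u v → Adj (Star n) u v → Adj (Star n) (φ ⟨$⟩ʳ u) (φ ⟨$⟩ʳ v)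
  forward zero    zero    adj rewrite 0↦0 = adj
  forward zero    (suc j) _   rewrite 0↦0 = inj₁ (refl , leaf↦leaf j)
  forward (suc i) zero    _   rewrite 0↦0 = inj₂ (refl , leaf↦leaf i)
  forward (suc i) (suc j) (inj₁ (() , _))
  forward (suc i) (suc j) (inj₂ (() , _))
  backward : ∀ u v → Adj (Star n) (φ ⟨$⟩ʳ u) (φ ⟨$⟩ʳ v) → Adj (Star n) u v
  backward zero    zero    adj rewrite 0↦0 = adj
  backward zero    (suc j) _ = inj₁ (refl , s≤s z≤n)
  backward (suc i) zero    _ = inj₂ (refl , s≤s z≤n)
  backward (suc i) (suc j) (inj₁ (i↦0 , _)) = ⊥-elim (n≮0 (subst (1 ≤_) i↦0 (leaf↦leaf i)))
  backward (suc i) (suc j) (inj₂ (j↦0 , _)) = ⊥-elim (n≮0 (subst (1 ≤_) j↦0 (leaf↦leaf j)))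

transpose-fixes : (i j k : Fin n) → k ≢ i → k ≢ j → PC.transpose i j k ≡ k
transpose-fixes i j k k≢i k≢j with k ≟ᶠ i
... | yes k≡i = ⊥-elim (k≢i k≡i)
... | no _ with k ≟ᶠ j
...   | yes k≡j = ⊥-elim (k≢j k≡j)
...   | no _    = refl

transpose-left : (i j : Fin n) → PC.transpose i j i ≡ j
transpose-left i j with i ≟ᶠ i
... | yes _   = refl
... | no i≢i = ⊥-elim (i≢i refl)

∃-∉-of-short : (xs : List (Fin n)) → length xs < n → ∃ λ a → a ∉ xs
∃-∉-of-short {n} xs short with all? (λ a → DecMem._∈?_ _≟ᶠ_ a xs)
... | no ¬all  = ¬∀⟶∃¬ n _ (λ a → DecMem._∈?_ _≟ᶠ_ a xs) ¬all
... | yes all∈ = ⊥-elim (<⇒≱ short (injective⇒≤ {f = position} position-injective))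
  where
  position : Fin n → Fin (length xs)
  position a = Any.index (all∈ a)
  position-injective : ∀ {a b} → position a ≡ position b → a ≡ b
  position-injective {a} {b} same =
    trans (lookup-index (all∈ a)) (trans (cong (lookup xs) same) (sym (lookup-index (all∈ b))))

-- The non-central endpoint of an edge of the star; junk on the non-edge (0 , 0).
leaf : Fin (suc n) × Fin (suc n) → Fin (suc n)
leaf (zero  , v) = v
leaf (suc u , _) = suc u

Star-edge-endpoints : {u v : Fin (suc n)} → Adj (Star n) u v →
  (u ≡ zero ⊎ u ≡ leaf (u , v)) × (v ≡ zero ⊎ v ≡ leaf (u , v))
Star-edge-endpoints {u = zero}  _                = inj₁ refl , inj₂ refl
Star-edge-endpoints {u = suc _} (inj₂ (v≡0 , _)) = inj₂ refl , inj₁ (toℕ-injective v≡0)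

touched : List (Edge (Star n)) → List (Fin (suc n))
touched T = zero ∷ map leaf T

length-touched : (T : List (Edge (Star n))) → length (touched T) ≡ suc (length T)
length-touched T = cong suc (length-map leaf T)

untouched-transposition-refutes : (T : List (Edge (Star n))) (a b : Fin (suc n)) →
  a ∉ touched T → b ∉ a ∷ touched T → ¬ IsEdgeDetermining (Star n) T
untouched-transposition-refutes {n} T a b a∉ b∉ determining@(edges , _) =
  moved⇒¬IsEdgeDetermining (Star n) τ a (centre-fixing-isAutomorphism τ (fixes-touched zero (here refl)))
    fixes-edges (λ a↦a → b∉ (here (trans (sym (transpose-left a b)) a↦a))) determining
  where
  τ : Permutation′ (suc n)
  τ = transpose a b
  fixes-touched : ∀ w → w ∈ touched T → τ ⟨$⟩ʳ w ≡ w
  fixes-touched w w∈ = transpose-fixes a b w (λ w≡a → a∉ (subst (_∈ touched T) w≡a w∈))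
                                             (λ w≡b → b∉ (there (subst (_∈ touched T) w≡b w∈)))
  endpoint-touched : ∀ {e} → e ∈ T → ∀ {w} → w ≡ zero ⊎ w ≡ leaf e → w ∈ touched T
  endpoint-touched _  (inj₁ refl) = here refl
  endpoint-touched e∈ (inj₂ refl) = there (∈-map⁺ leaf e∈)
  fixes-edges : ∀ e → e ∈ T → FixesEdge (Star n) τ e
  fixes-edges (u , v) e∈ with u-end , v-end ← Star-edge-endpoints (All.lookup edges e∈) =
    inj₁ (fixes-touched u (endpoint-touched e∈ u-end) , fixes-touched v (endpoint-touched e∈ v-end))

Star-short-not-determining : ∀ k (T : List (Edge (Star (2 + k)))) → length T ≤ k →
  ¬ IsEdgeDetermining (Star (2 + k)) T
Star-short-not-determining k T short
  with a , a∉ ← ∃-∉-of-short (touched T)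
                   (s≤s (≤-trans (≤-reflexive (length-touched T)) (s≤s (m≤n⇒m≤1+n short))))
  with b , b∉ ← ∃-∉-of-short (a ∷ touched T)
                   (s≤s (s≤s (≤-trans (≤-reflexive (length-touched T)) (s≤s short))))
  = untouched-transposition-refutes T a b a∉ b∉

Star-index : ∀ n → 1 < n → DetIndex (Star n) (n ∸ 1)
Star-index (suc (suc k)) _ = (T , length-T , (map⁺ (All.universal spoke-edge _)) , determined) , lower-bound
  where
  S : Graph
  S = Star (2 + k)
  spoke : Fin (suc k) → Edge S
  spoke j = zero , suc (suc j)
  T : List (Edge S)
  T = map spoke (allFin (suc k))
  length-T : length T ≡ suc k
  length-T = trans (length-map spoke (allFin (suc k))) (length-tabulate (λ j → j))
  spoke-edge : (j : Fin (suc k)) → Adj S zero (suc (suc j))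
  spoke-edge _ = inj₁ (refl , s≤s z≤n)
  fixed-off-leaf-1 : ∀ φ → IsAutomorphism S φ → (∀ e → e ∈ T → FixesEdge S φ e) →
    ∀ y → y ≢ suc zero → φ ⟨$⟩ʳ y ≡ y
  fixed-off-leaf-1 φ φ-aut fixes zero          _   = Star-automorphism-fixes-centre φ φ-aut
  fixed-off-leaf-1 φ φ-aut fixes (suc zero)    y≢1 = ⊥-elim (y≢1 refl)
  fixed-off-leaf-1 φ φ-aut fixes (suc (suc j)) _   =
    other-endpoint-fixed S φ (fixes (spoke j) (∈-map⁺ spoke (∈-allFin j)))
      (Star-automorphism-fixes-centre φ φ-aut) (λ ())
  determined : ∀ φ → IsAutomorphism S φ → (∀ e → e ∈ T → FixesEdge S φ e) → ∀ x → φ ⟨$⟩ʳ x ≡ x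
  determined φ φ-aut fixes x with x ≟ᶠ suc zero
  ... | yes refl = fixed-if-others-fixed φ (fixed-off-leaf-1 φ φ-aut fixes)
  ... | no x≢1   = fixed-off-leaf-1 φ φ-aut fixes x x≢1
  lower-bound : ∀ T → IsEdgeDetermining S T → suc k ≤ length T
  lower-bound T determining = ≮⇒≥ λ short → Star-short-not-determining k T (≤-pred short) determining
Star-index (suc zero) (s≤s ())

theorem2 : (∀ n → 2 < n → DetIndex (Path n) 1)
    × (∀ n → 3 ≤ n → DetIndex (Cycle n) 2)
    × (∀ n → 1 < n → DetIndex (Star n) (n ∸ 1))
theorem2 = Path-index , Cycle-index , Star-index
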